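{- Let $n\in\mathbb{N}$ and $s\in\mathbb{C}\setminus\{ -1,-2,-3,\dots\}$. Then \[ \sum_{k=1}^{n}\binom{s+n}{k}\frac{(-1)^{k-1}}{k}=H_n+ s\sum_{k=0}^{n-1}\frac{(-1)^k\binom{s+k}{k}}{(k+1)^2\binom{n}{k+1}}. \]
   Context: $H_n=\sum_{j=1}^n\frac1j$. For $z\in\mathbb{C}$ and $k\in\mathbb{N}_0$, $\binom{z}{k}=\frac{z(z-1)\cdots(z-k+1)}{k!}$. -}

module Defs where

open import Level using (Level)
open import Data.Nat as ℕ using (ℕ; zero; suc)
open import Data.Nat.Combinatorics using (_C_)
open import Algebra.Bundles using (CommutativeRing)

-- Generic definitions inside a commutative ring R (a stand-in for ℂ),
-- given a function `inv` meant to pick inverses of positive naturals.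
module Gen {c ℓ : Level} (R : CommutativeRing c ℓ) (inv : ℕ → CommutativeRing.Carrier R) where
  open CommutativeRing R

  cast : ℕ → Carrier
  cast zero    = 0#
  cast (suc m) = 1# + cast m

  sumTo : ℕ → (ℕ → Carrier) → Carrier
  sumTo zero    f = 0#
  sumTo (suc m) f = sumTo m f + f m

  prodTo : ℕ → (ℕ → Carrier) → Carrier
  prodTo zero    f = 1#
  prodTo (suc m) f = prodTo m f * f m

  sgn : ℕ → Carrier
  sgn zero    = 1#
  sgn (suc k) = - sgn k

  binom : Carrier → ℕ → Carrier
  binom z k = prodTo k (λ j → z - cast j) * inv (k ℕ.!)

  H : ℕ → Carrier
  H n = sumTo n (λ i → inv (suc i))

  -- Σ_{k=1}^n binom(s+n,k) (-1)^(k-1)/k   (reindexed k = i+1, i = 0..n-1)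
  lhs : ℕ → Carrier → Carrier
  lhs n s = sumTo n (λ i → binom (s + cast n) (suc i) * sgn i * inv (suc i))

  rhs : ℕ → Carrier → Carrier
  rhs n s = H n + s * sumTo n (λ k →
              sgn k * binom (s + cast k) k
                * inv ((suc k ℕ.* suc k) ℕ.* (n C suc k)))

module Submission where

-- Induct on n, trading n for s: as s + (n + 1) = (s + 1) + n, the left side satisfies
-- L(n+1, s) = L(n, s+1) + (-1)^n C(s+n+1, n+1)/(n+1). The right side obeys the same recursion:
-- after rewriting s C(s+k, k)/(k+1) as C(s+k, k+1), Pascal's rule in the upper argument and the
-- partial fraction 1/((k+1) C(n, k+1)) = 1/((n+1) C(n, k)) + 1/((n+1) C(n, k+1)) turn
-- R(n+1, s) - R(n, s+1) into a telescoping sum.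

open import Level using (Level)
open import Algebra.Bundles using (CommutativeRing)
open import Algebra.Solver.Ring.AlmostCommutativeRing using (_-Raw-AlmostCommutative⟶_; fromCommutativeRing)
open import Data.Maybe using (Maybe; just; nothing)
open import Data.Nat as ℕ using (ℕ; zero; suc; _<_; _≤_; s≤s; z≤n; NonZero)
import Data.Nat.Properties as ℕP
open import Data.Integer as ℤ using (ℤ; +_; -[1+_])
import Data.Integer.Properties as ℤP
open import Data.Sign as Sign using (Sign)
open import Relation.Nullary using (¬_; yes; no)
open import Relation.Binary.PropositionalEquality as P using (_≡_)
open import Data.Nat.Combinatorics using (_C_; nC1≡n; nCn≡1; nCk+nC[k+1]≡[n+1]C[k+1])
open import Defs

module _ where
  open import Data.Nat.Base using (_+_; _*_)
  open import Data.Nat.Solver using (module +-*-Solver)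
  open +-*-Solver
  open P.≡-Reasoning

  [k+1]*[n+1]C[k+1]≡[n+1]*nCk : ∀ n k → suc k * (suc n C suc k) ≡ suc n * (n C k)
  [k+1]*[n+1]C[k+1]≡[n+1]*nCk zero    zero    = P.refl
  [k+1]*[n+1]C[k+1]≡[n+1]*nCk zero    (suc k) = ℕP.*-zeroʳ (suc (suc k))
  [k+1]*[n+1]C[k+1]≡[n+1]*nCk (suc n) zero    = begin
    1 * (suc (suc n) C 1)  ≡⟨ ℕP.*-identityˡ _ ⟩
    suc (suc n) C 1        ≡⟨ nC1≡n (suc (suc n)) ⟩
    suc (suc n)            ≡⟨ ℕP.*-identityʳ _ ⟨
    suc (suc n) * 1        ∎
  [k+1]*[n+1]C[k+1]≡[n+1]*nCk (suc n) (suc k) = begin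
    suc (suc k) * (suc (suc n) C suc (suc k))
      ≡⟨ P.cong (suc (suc k) *_) (nCk+nC[k+1]≡[n+1]C[k+1] (suc n) (suc k)) ⟨
    suc (suc k) * (X + Y)
      ≡⟨ solve 3 (λ k x y → (con 1 :+ k) :* (x :+ y) := x :+ k :* x :+ (con 1 :+ k) :* y) P.refl (suc k) X Y ⟩
    X + suc k * X + suc (suc k) * Y
      ≡⟨ P.cong₂ (λ u v → X + u + v) ([k+1]*[n+1]C[k+1]≡[n+1]*nCk n k) ([k+1]*[n+1]C[k+1]≡[n+1]*nCk n (suc k)) ⟩
    X + suc n * (n C k) + suc n * (n C suc k)
      ≡⟨ solve 4 (λ x m a b → x :+ m :* a :+ m :* b := x :+ m :* (a :+ b)) P.refl X (suc n) (n C k) (n C suc k) ⟩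
    X + suc n * (n C k + n C suc k)
      ≡⟨ P.cong (λ u → X + suc n * u) (nCk+nC[k+1]≡[n+1]C[k+1] n k) ⟩
    X + suc n * X
      ∎
    where
    X = suc n C suc k
    Y = suc n C suc (suc k)

  k≤n⇒nCk>0 : ∀ {n k} → k ≤ n → 0 < n C k
  k≤n⇒nCk>0 {n}     {zero}  _         = s≤s z≤n
  k≤n⇒nCk>0 {suc n} {suc k} (s≤s k≤n) = P.subst (0 <_) (nCk+nC[k+1]≡[n+1]C[k+1] n k)
    (ℕP.≤-trans (k≤n⇒nCk>0 k≤n) (ℕP.m≤m+n _ _))

  k≤n⇒nCk≢0 : ∀ {n k} → k ≤ n → NonZero (n C k)
  k≤n⇒nCk≢0 k≤n = ℕ.>-nonZero (k≤n⇒nCk>0 k≤n)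

  -- 1/((k+1)·C(n,k+1)) = 1/((n+1)·C(n,k)) + 1/((n+1)·C(n,k+1)), denominators cleared
  [k+1]*nC[k+1]-reciprocal-split : ∀ n k →
    suc k * (n C suc k) * (suc n * (n C k) + suc n * (n C suc k)) ≡ (suc n * (n C k)) * (suc n * (n C suc k))
  [k+1]*nC[k+1]-reciprocal-split n k = begin
    suc k * A * (suc n * B + suc n * A)
      ≡⟨ solve 4 (λ k m a b → k :* a :* (m :* b :+ m :* a) := a :* m :* (k :* (b :+ a))) P.refl (suc k) (suc n) A B ⟩
    A * suc n * (suc k * (B + A))
      ≡⟨ P.cong (λ u → A * suc n * (suc k * u)) (nCk+nC[k+1]≡[n+1]C[k+1] n k) ⟩
    A * suc n * (suc k * (suc n C suc k))
      ≡⟨ P.cong (λ u → A * suc n * u) ([k+1]*[n+1]C[k+1]≡[n+1]*nCk n k) ⟩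
    A * suc n * (suc n * B)
      ≡⟨ solve 3 (λ m a b → a :* m :* (m :* b) := (m :* b) :* (m :* a)) P.refl (suc n) A B ⟩
    (suc n * B) * (suc n * A)
      ∎
    where
    A = n C suc k
    B = n C k

-- Cancellation such as x - x ≈ 0 is out of reach of a solver whose coefficients live in R
-- itself, so the ring solver is run with integer coefficients.
module IntegerCoefficients {c ℓ : Level} (R : CommutativeRing c ℓ) where
  open CommutativeRing R
  open import Algebra.Properties.Ring ring using (-‿involutive; -‿distribˡ-*; -‿distribʳ-*; -‿+-comm; -0#≈0#)
  open import Algebra.Properties.Semiring.Mult.TCOptimised semiring using (_×_; 1+×; ×-homo-+; ×1-homo-*)
  open import Relation.Binary.Reasoning.Setoid setoid

  fromSign : Sign → Carrier → Carrier
  fromSign Sign.+ x = x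
  fromSign Sign.- x = - x

  fromℤ : ℤ → Carrier
  fromℤ i = fromSign (ℤ.sign i) (ℤ.∣ i ∣ × 1#)

  fromSign-homo-* : ∀ s t x y → fromSign (s Sign.* t) (x * y) ≈ fromSign s x * fromSign t y
  fromSign-homo-* Sign.+ Sign.+ x y = refl
  fromSign-homo-* Sign.+ Sign.- x y = -‿distribʳ-* x y
  fromSign-homo-* Sign.- Sign.+ x y = -‿distribˡ-* x y
  fromSign-homo-* Sign.- Sign.- x y = begin
    x * y         ≈⟨ -‿involutive (x * y) ⟨
    - - (x * y)   ≈⟨ -‿cong (-‿distribʳ-* x y) ⟩
    - (x * - y)   ≈⟨ -‿distribˡ-* x (- y) ⟩
    - x * - y     ∎

  fromℤ-◃ : ∀ s n → fromℤ (s ℤ.◃ n) ≈ fromSign s (n × 1#)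
  fromℤ-◃ Sign.+ zero    = refl
  fromℤ-◃ Sign.- zero    = sym -0#≈0#
  fromℤ-◃ Sign.+ (suc n) = refl
  fromℤ-◃ Sign.- (suc n) = refl

  fromℤ-homo-* : ∀ i j → fromℤ (i ℤ.* j) ≈ fromℤ i * fromℤ j
  fromℤ-homo-* i j = begin
    fromℤ (i ℤ.* j)
      ≈⟨ fromℤ-◃ (ℤ.sign i Sign.* ℤ.sign j) (ℤ.∣ i ∣ ℕ.* ℤ.∣ j ∣) ⟩
    fromSign (ℤ.sign i Sign.* ℤ.sign j) ((ℤ.∣ i ∣ ℕ.* ℤ.∣ j ∣) × 1#)
      ≈⟨ fromSign-cong (ℤ.sign i Sign.* ℤ.sign j) (×1-homo-* ℤ.∣ i ∣ ℤ.∣ j ∣) ⟩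
    fromSign (ℤ.sign i Sign.* ℤ.sign j) ((ℤ.∣ i ∣ × 1#) * (ℤ.∣ j ∣ × 1#))
      ≈⟨ fromSign-homo-* (ℤ.sign i) (ℤ.sign j) _ _ ⟩
    fromℤ i * fromℤ j
      ∎
    where
    fromSign-cong : ∀ s {x y} → x ≈ y → fromSign s x ≈ fromSign s y
    fromSign-cong Sign.+ x≈y = x≈y
    fromSign-cong Sign.- x≈y = -‿cong x≈y

  fromℤ-homo-- : ∀ i → fromℤ (ℤ.- i) ≈ - fromℤ i
  fromℤ-homo-- (+ zero)  = sym -0#≈0#
  fromℤ-homo-- (+ suc n) = refl
  fromℤ-homo-- -[1+ n ]  = sym (-‿involutive _)

  fromℤ-⊖ : ∀ m n → fromℤ (m ℤ.⊖ n) ≈ m × 1# - n × 1#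
  fromℤ-⊖ m zero = begin
    fromℤ (m ℤ.⊖ 0)   ≡⟨ P.cong fromℤ (ℤP.⊖-≥ {m} ℕ.z≤n) ⟩
    m × 1#            ≈⟨ +-identityʳ _ ⟨
    m × 1# + 0#       ≈⟨ +-congˡ -0#≈0# ⟨
    m × 1# - 0#       ∎
  fromℤ-⊖ zero (suc n) = sym (+-identityˡ _)
  fromℤ-⊖ (suc m) (suc n) = begin
    fromℤ (suc m ℤ.⊖ suc n)                ≡⟨ P.cong fromℤ (ℤP.[1+m]⊖[1+n]≡m⊖n m n) ⟩
    fromℤ (m ℤ.⊖ n)                        ≈⟨ fromℤ-⊖ m n ⟩
    m × 1# - n × 1#                        ≈⟨ +-cancel-shared 1# (m × 1#) (n × 1#) ⟨
    (1# + m × 1#) - (1# + n × 1#)          ≈⟨ +-cong (1+× m 1#) (-‿cong (1+× n 1#)) ⟨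
    suc m × 1# - suc n × 1#                ∎
    where
    +-cancel-shared : ∀ a x y → (a + x) - (a + y) ≈ x - y
    +-cancel-shared a x y = begin
      (a + x) + - (a + y)    ≈⟨ +-cong (+-comm x a) (-‿+-comm a y) ⟨
      (x + a) + (- a + - y)  ≈⟨ +-assoc x a _ ⟩
      x + (a + (- a + - y))  ≈⟨ +-congˡ (+-assoc a (- a) (- y)) ⟨
      x + ((a - a) + - y)    ≈⟨ +-congˡ (+-congʳ (-‿inverseʳ a)) ⟩
      x + (0# + - y)         ≈⟨ +-congˡ (+-identityˡ _) ⟩
      x - y                  ∎

  fromℤ-homo-+ : ∀ i j → fromℤ (i ℤ.+ j) ≈ fromℤ i + fromℤ j
  fromℤ-homo-+ (+ m)    (+ n)    = ×-homo-+ 1# m n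
  fromℤ-homo-+ (+ m)    -[1+ n ] = fromℤ-⊖ m (suc n)
  fromℤ-homo-+ -[1+ m ] (+ n)    = trans (fromℤ-⊖ n (suc m)) (+-comm _ _)
  fromℤ-homo-+ -[1+ m ] -[1+ n ] = begin
    - (suc (suc (m ℕ.+ n)) × 1#)            ≡⟨ P.cong (λ k → - (suc k × 1#)) (ℕP.+-suc m n) ⟨
    - ((suc m ℕ.+ suc n) × 1#)              ≈⟨ -‿cong (×-homo-+ 1# (suc m) (suc n)) ⟩
    - (suc m × 1# + suc n × 1#)             ≈⟨ -‿+-comm _ _ ⟨
    - (suc m × 1#) + - (suc n × 1#)         ∎

  homomorphism : ℤ.+-*-rawRing -Raw-AlmostCommutative⟶ fromCommutativeRing R
  homomorphism = record
    { ⟦_⟧ = fromℤ ; +-homo = fromℤ-homo-+ ; *-homo = fromℤ-homo-* ; -‿homo = fromℤ-homo--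
    ; 0-homo = refl ; 1-homo = refl }

  fromℤ-≟ : ∀ i j → Maybe (fromℤ i ≈ fromℤ j)
  fromℤ-≟ i j with i ℤ.≟ j
  ... | yes P.refl = just refl
  ... | no _       = nothing

  open import Algebra.Solver.Ring ℤ.+-*-rawRing (fromCommutativeRing R) homomorphism fromℤ-≟ public

module InvertiblePositiveIntegers {c ℓ : Level} (R : CommutativeRing c ℓ) (inv : ℕ → CommutativeRing.Carrier R)
  (inv-correct : ∀ m → CommutativeRing._≈_ R (CommutativeRing._*_ R (Gen.cast R inv (suc m)) (inv (suc m))) (CommutativeRing.1# R)) where
  open CommutativeRing R hiding (zero)
  open Gen R inv
  open IntegerCoefficients R using (solve; _:=_; _:+_; _:-_; _:*_; :-_; con)
  open import Algebra.Properties.Ring ring using (-0#≈0#)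
  open import Algebra.Properties.Semiring.Mult.TCOptimised semiring using (_×_; 1+×; ×-homo-+; ×1-homo-*)
  open import Relation.Binary.Reasoning.Setoid setoid

  cast≈×1 : ∀ n → cast n ≈ n × 1#
  cast≈×1 zero    = refl
  cast≈×1 (suc n) = trans (+-congˡ (cast≈×1 n)) (sym (1+× n 1#))

  cast-homo-+ : ∀ m n → cast (m ℕ.+ n) ≈ cast m + cast n
  cast-homo-+ m n = trans (cast≈×1 (m ℕ.+ n))
    (trans (×-homo-+ 1# m n) (sym (+-cong (cast≈×1 m) (cast≈×1 n))))

  cast-homo-* : ∀ m n → cast (m ℕ.* n) ≈ cast m * cast n
  cast-homo-* m n = trans (cast≈×1 (m ℕ.* n))
    (trans (×1-homo-* m n) (sym (*-cong (cast≈×1 m) (cast≈×1 n))))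

  cast*inv≈1 : ∀ m .{{_ : NonZero m}} → cast m * inv m ≈ 1#
  cast*inv≈1 (suc m) = inv-correct m

  cast-*-cancelˡ : ∀ m .{{_ : NonZero m}} {x y} → cast m * x ≈ cast m * y → x ≈ y
  cast-*-cancelˡ m {x} {y} mx≈my = begin
    x                     ≈⟨ *-identityˡ x ⟨
    1# * x                ≈⟨ *-congʳ (trans (*-comm _ _) (cast*inv≈1 m)) ⟨
    (inv m * cast m) * x  ≈⟨ *-assoc _ _ _ ⟩
    inv m * (cast m * x)  ≈⟨ *-congˡ mx≈my ⟩
    inv m * (cast m * y)  ≈⟨ *-assoc _ _ _ ⟨
    (inv m * cast m) * y  ≈⟨ *-congʳ (trans (*-comm _ _) (cast*inv≈1 m)) ⟩
    1# * y                ≈⟨ *-identityˡ y ⟩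
    y                     ∎

  inv-unique : ∀ m .{{_ : NonZero m}} x → cast m * x ≈ 1# → x ≈ inv m
  inv-unique m x mx≈1 = cast-*-cancelˡ m (trans mx≈1 (sym (cast*inv≈1 m)))

  inv-1 : inv 1 ≈ 1#
  inv-1 = sym (inv-unique 1 1# (trans (*-identityʳ _) (+-identityʳ 1#)))

  inv-homo-* : ∀ a b .{{_ : NonZero a}} .{{_ : NonZero b}} → inv (a ℕ.* b) ≈ inv a * inv b
  inv-homo-* a b = sym (inv-unique (a ℕ.* b) {{ℕP.m*n≢0 a b}} (inv a * inv b) (begin
    cast (a ℕ.* b) * (inv a * inv b)     ≈⟨ *-congʳ (cast-homo-* a b) ⟩
    (cast a * cast b) * (inv a * inv b)  ≈⟨ interchange _ _ _ _ ⟩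
    (cast a * inv a) * (cast b * inv b)  ≈⟨ *-cong (cast*inv≈1 a) (cast*inv≈1 b) ⟩
    1# * 1#                              ≈⟨ *-identityˡ 1# ⟩
    1#                                   ∎))
    where open import Algebra.Properties.CommutativeSemigroup *-commutativeSemigroup using (interchange)

  inv-partial-fractions : ∀ a b d .{{_ : NonZero a}} .{{_ : NonZero b}} .{{_ : NonZero d}} →
    a ℕ.* (b ℕ.+ d) ≡ b ℕ.* d → inv a ≈ inv b + inv d
  inv-partial-fractions a b d a[b+d]≡bd = sym (inv-unique a (inv b + inv d)
    (cast-*-cancelˡ (b ℕ.* d) {{ℕP.m*n≢0 b d}} (begin
      cast (b ℕ.* d) * (A * (inv b + inv d))    ≈⟨ *-congʳ (cast-homo-* b d) ⟩
      (B * D) * (A * (inv b + inv d))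
        ≈⟨ solve 5 (λ a b d x y → (b :* d) :* (a :* (x :+ y)) := a :* (d :* (b :* x) :+ b :* (d :* y)))
                 refl A B D (inv b) (inv d) ⟩
      A * (D * (B * inv b) + B * (D * inv d))
        ≈⟨ *-congˡ (+-cong (*-congˡ (cast*inv≈1 b)) (*-congˡ (cast*inv≈1 d))) ⟩
      A * (D * 1# + B * 1#)
        ≈⟨ *-congˡ (trans (+-cong (*-identityʳ D) (*-identityʳ B)) (+-comm D B)) ⟩
      A * (B + D)                              ≈⟨ *-congˡ (cast-homo-+ b d) ⟨
      A * cast (b ℕ.+ d)                       ≈⟨ cast-homo-* a (b ℕ.+ d) ⟨
      cast (a ℕ.* (b ℕ.+ d))                   ≡⟨ P.cong cast a[b+d]≡bd ⟩
      cast (b ℕ.* d)                           ≈⟨ *-identityʳ _ ⟨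
      cast (b ℕ.* d) * 1#                      ∎)))
    where
    A = cast a
    B = cast b
    D = cast d

  sumTo-cong< : ∀ n {f g : ℕ → Carrier} → (∀ k → k < n → f k ≈ g k) → sumTo n f ≈ sumTo n g
  sumTo-cong< zero    f≈g = refl
  sumTo-cong< (suc n) f≈g = +-cong (sumTo-cong< n (λ k k<n → f≈g k (ℕP.m<n⇒m<1+n k<n))) (f≈g n ℕP.≤-refl)

  sumTo-distrib-+ : ∀ n (f g : ℕ → Carrier) → sumTo n (λ k → f k + g k) ≈ sumTo n f + sumTo n g
  sumTo-distrib-+ zero    f g = sym (+-identityˡ 0#)
  sumTo-distrib-+ (suc n) f g = trans (+-congʳ (sumTo-distrib-+ n f g))
    (solve 4 (λ a b x y → (a :+ b) :+ (x :+ y) := (a :+ x) :+ (b :+ y)) refl (sumTo n f) (sumTo n g) (f n) (g n))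

  *-distribˡ-sumTo : ∀ n x (f : ℕ → Carrier) → x * sumTo n f ≈ sumTo n (λ k → x * f k)
  *-distribˡ-sumTo zero    x f = zeroʳ x
  *-distribˡ-sumTo (suc n) x f = trans (distribˡ x _ _) (+-congʳ (*-distribˡ-sumTo n x f))

  sumTo-telescope : ∀ n (g : ℕ → Carrier) → sumTo n (λ k → g (suc k) - g k) ≈ g n - g 0
  sumTo-telescope zero    g = sym (-‿inverseʳ (g 0))
  sumTo-telescope (suc n) g = trans (+-congʳ (sumTo-telescope n g))
    (solve 3 (λ a b z → (b :- z) :+ (a :- b) := a :- z) refl (g (suc n)) (g n) (g 0))

  prodTo-cong : ∀ n {f g : ℕ → Carrier} → (∀ k → f k ≈ g k) → prodTo n f ≈ prodTo n g
  prodTo-cong zero    f≈g = refl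
  prodTo-cong (suc n) f≈g = *-cong (prodTo-cong n f≈g) (f≈g n)

  prodTo-suc : ∀ n (f : ℕ → Carrier) → prodTo (suc n) f ≈ f 0 * prodTo n (λ k → f (suc k))
  prodTo-suc zero    f = trans (*-identityˡ _) (sym (*-identityʳ _))
  prodTo-suc (suc n) f = trans (*-congʳ (prodTo-suc n f)) (*-assoc _ _ _)

  binom-zero : ∀ z → binom z 0 ≈ 1#
  binom-zero z = trans (*-identityˡ _) inv-1

  binom-cong : ∀ {z w} k → z ≈ w → binom z k ≈ binom w k
  binom-cong k z≈w = *-congʳ (prodTo-cong k (λ j → +-congʳ z≈w))

  inv-suc! : ∀ k → inv (suc k ℕ.!) ≈ inv (suc k) * inv (k ℕ.!)
  inv-suc! k = inv-homo-* (suc k) (k ℕ.!) {{_}} {{k ℕP.!≢0}}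

  binom-suc : ∀ z k → binom z (suc k) ≈ binom z k * (z - cast k) * inv (suc k)
  binom-suc z k = begin
    (P * (z - cast k)) * inv (suc k ℕ.!)          ≈⟨ *-congˡ (inv-suc! k) ⟩
    (P * (z - cast k)) * (inv (suc k) * inv (k ℕ.!))
      ≈⟨ solve 4 (λ a b c d → (a :* b) :* (c :* d) := a :* d :* b :* c) refl P (z - cast k) (inv (suc k)) (inv (k ℕ.!)) ⟩
    binom z k * (z - cast k) * inv (suc k)        ∎
    where P = prodTo k (λ j → z - cast j)

  binom-pascal : ∀ z k → binom (z + 1#) (suc k) ≈ binom z (suc k) + binom z k
  binom-pascal z k = begin
    prodTo (suc k) (λ j → (z + 1#) - cast j) * inv (suc k ℕ.!)
      ≈⟨ *-congʳ (prodTo-suc k _) ⟩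
    ((z + 1#) - 0#) * prodTo k (λ j → (z + 1#) - cast (suc j)) * inv (suc k ℕ.!)
      ≈⟨ *-congʳ (*-cong (trans (+-congˡ -0#≈0#) (+-identityʳ _)) (prodTo-cong k shift)) ⟩
    (z + 1#) * P * inv (suc k ℕ.!)
      ≈⟨ *-congˡ (inv-suc! k) ⟩
    (z + 1#) * P * (inv (suc k) * inv (k ℕ.!))
      ≈⟨ solve 5 (λ z p i j x → (z :+ con (+ 1)) :* p :* (i :* j)
                              := p :* (z :- x) :* (i :* j) :+ p :* ((con (+ 1) :+ x) :* i) :* j)
                 refl z P (inv (suc k)) (inv (k ℕ.!)) (cast k) ⟩
    P * (z - cast k) * (inv (suc k) * inv (k ℕ.!)) + P * (cast (suc k) * inv (suc k)) * inv (k ℕ.!)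
      ≈⟨ +-cong (*-congˡ (inv-suc! k)) (sym (*-congʳ (trans (*-congˡ (inv-correct k)) (*-identityʳ P)))) ⟨
    binom z (suc k) + binom z k
      ∎
    where
    P = prodTo k (λ j → z - cast j)
    shift : ∀ j → (z + 1#) - cast (suc j) ≈ z - cast j
    shift j = solve 2 (λ z x → (z :+ con (+ 1)) :- (con (+ 1) :+ x) := z :- x) refl z (cast j)

  binom-suc-diagonal : ∀ s k → binom (s + cast k) (suc k) ≈ s * binom (s + cast k) k * inv (suc k)
  binom-suc-diagonal s k = trans (binom-suc (s + cast k) k)
    (*-congʳ (trans (*-congˡ (solve 2 (λ s x → (s :+ x) :- x := s) refl s (cast k))) (*-comm _ _)))

  binom-pascal-diagonal : ∀ s k →
    binom (s + cast (suc k)) (suc k) ≈ binom (s + cast k) (suc k) + binom (s + cast k) k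
  binom-pascal-diagonal s k = trans
    (binom-cong (suc k) (solve 2 (λ s x → s :+ (con (+ 1) :+ x) := (s :+ x) :+ con (+ 1)) refl s (cast k)))
    (binom-pascal (s + cast k) k)

  sgnBinom : Carrier → ℕ → Carrier
  sgnBinom s k = sgn k * binom (s + cast k) k

  sgnBinom′ : Carrier → ℕ → Carrier
  sgnBinom′ s k = sgn k * binom (s + cast k) (suc k)

  sgnBinom′-shift : ∀ s k → sgnBinom′ (s + 1#) k ≈ sgnBinom′ s k + sgnBinom s k
  sgnBinom′-shift s k = trans
    (*-congˡ (trans (binom-cong (suc k) (solve 2 (λ s x → (s :+ con (+ 1)) :+ x := s :+ (con (+ 1) :+ x)) refl s (cast k)))
                    (binom-pascal-diagonal s k)))
    (distribˡ (sgn k) _ _)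

  sgnBinom-suc : ∀ s k → sgnBinom s (suc k) ≈ - (sgnBinom′ s k + sgnBinom s k)
  sgnBinom-suc s k = trans (*-congˡ (binom-pascal-diagonal s k))
    (solve 3 (λ e b₁ b₀ → (:- e) :* (b₁ :+ b₀) := :- (e :* b₁ :+ e :* b₀)) refl (sgn k) _ _)

  rhs′ : ℕ → Carrier → Carrier
  rhs′ n s = H n + sumTo n (λ k → sgnBinom′ s k * inv (suc k ℕ.* (n C suc k)))

  rhs≈rhs′ : ∀ n s → rhs n s ≈ rhs′ n s
  rhs≈rhs′ n s = +-congˡ (trans (*-distribˡ-sumTo n s _) (sumTo-cong< n summand))
    where
    summand : ∀ k → k < n → s * (sgn k * binom (s + cast k) k * inv ((suc k ℕ.* suc k) ℕ.* (n C suc k)))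
                              ≈ sgnBinom′ s k * inv (suc k ℕ.* (n C suc k))
    summand k k<n = begin
      s * (sgn k * B * inv ((suc k ℕ.* suc k) ℕ.* (n C suc k)))
        ≡⟨ P.cong (λ m → s * (sgn k * B * inv m)) (ℕP.*-assoc (suc k) (suc k) (n C suc k)) ⟩
      s * (sgn k * B * inv (suc k ℕ.* (suc k ℕ.* (n C suc k))))
        ≈⟨ *-congˡ (*-congˡ (inv-homo-* (suc k) (suc k ℕ.* (n C suc k)))) ⟩
      s * (sgn k * B * (inv (suc k) * inv (suc k ℕ.* (n C suc k))))
        ≈⟨ solve 5 (λ s e b i j → s :* (e :* b :* (i :* j)) := e :* (s :* b :* i) :* j) refl s (sgn k) B (inv (suc k)) _ ⟩
      sgn k * (s * B * inv (suc k)) * inv (suc k ℕ.* (n C suc k))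
        ≈⟨ *-congʳ (*-congˡ (binom-suc-diagonal s k)) ⟨
      sgnBinom′ s k * inv (suc k ℕ.* (n C suc k))
        ∎
      where
      B = binom (s + cast k) k
      instance
        _ : NonZero (suc k ℕ.* (n C suc k))
        _ = ℕP.m*n≢0 (suc k) (n C suc k) {{_}} {{k≤n⇒nCk≢0 k<n}}

  lhs-suc : ∀ n s → lhs (suc n) s ≈ lhs n (s + 1#) + (sgnBinom′ s n + sgnBinom s n) * inv (suc n)
  lhs-suc n s = +-cong
    (sumTo-cong< n (λ i _ → *-congʳ (*-congʳ (binom-cong (suc i)
      (solve 2 (λ s x → s :+ (con (+ 1) :+ x) := (s :+ con (+ 1)) :+ x) refl s (cast n))))))
    (*-congʳ (trans (*-comm _ _) (trans (*-congˡ (binom-pascal-diagonal s n)) (distribˡ (sgn n) _ _))))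

  telescopingTerm : ℕ → Carrier → ℕ → Carrier
  telescopingTerm n s k = sgnBinom s k * inv (suc n ℕ.* (n C k))

  rhs′-summand-telescopes : ∀ n s k → k < n →
    sgnBinom′ s k * inv (suc k ℕ.* (suc n C suc k))
      ≈ sgnBinom′ (s + 1#) k * inv (suc k ℕ.* (n C suc k))
        + (telescopingTerm n s (suc k) - telescopingTerm n s k)
  rhs′-summand-telescopes n s k k<n = begin
    D * inv (suc k ℕ.* (suc n C suc k))       ≡⟨ P.cong (λ m → D * inv m) ([k+1]*[n+1]C[k+1]≡[n+1]*nCk n k) ⟩
    D * γ k
      ≈⟨ solve 4 (λ d c x y → d :* x := (d :+ c) :* (x :+ y) :+ ((:- (d :+ c)) :* y :- c :* x)) refl D E (γ k) (γ (suc k)) ⟩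
    (D + E) * (γ k + γ (suc k)) + ((- (D + E)) * γ (suc k) - E * γ k)
      ≈⟨ +-cong (*-cong (sgnBinom′-shift s k) partial-fractions) (+-congʳ (*-congʳ (sgnBinom-suc s k))) ⟨
    sgnBinom′ (s + 1#) k * inv (suc k ℕ.* (n C suc k))
      + (telescopingTerm n s (suc k) - telescopingTerm n s k)
      ∎
    where
    D = sgnBinom′ s k
    E = sgnBinom s k
    γ : ℕ → Carrier
    γ j = inv (suc n ℕ.* (n C j))
    instance
      _ : NonZero (n C k)
      _ = k≤n⇒nCk≢0 (ℕP.<⇒≤ k<n)
      _ : NonZero (n C suc k)
      _ = k≤n⇒nCk≢0 k<n
    partial-fractions : inv (suc k ℕ.* (n C suc k)) ≈ γ k + γ (suc k)
    partial-fractions = inv-partial-fractions _ _ _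
      {{ℕP.m*n≢0 (suc k) (n C suc k)}} {{ℕP.m*n≢0 (suc n) (n C k)}} {{ℕP.m*n≢0 (suc n) (n C suc k)}}
      ([k+1]*nC[k+1]-reciprocal-split n k)

  rhs′-suc : ∀ n s → rhs′ (suc n) s ≈ rhs′ n (s + 1#) + (sgnBinom′ s n + sgnBinom s n) * inv (suc n)
  rhs′-suc n s = begin
    (H n + I) + (sumTo n (λ k → sgnBinom′ s k * inv (suc k ℕ.* (suc n C suc k)))
                  + D * inv (suc n ℕ.* (suc n C suc n)))
      ≈⟨ +-congˡ (+-cong telescoped (*-congˡ (inv-[n+1]*[m]Cm (suc n)))) ⟩
    (H n + I) + ((Σ + (G n - G 0)) + D * I)
      ≈⟨ +-congˡ (+-congʳ (+-congˡ (+-cong (*-congˡ (inv-[n+1]*[m]Cm n)) (-‿cong G0≈I)))) ⟩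
    (H n + I) + ((Σ + (E * I - I)) + D * I)
      ≈⟨ solve 5 (λ h i σ e d → (h :+ i) :+ ((σ :+ (e :* i :- i)) :+ d :* i) := (h :+ σ) :+ (d :+ e) :* i)
                 refl (H n) I Σ E D ⟩
    (H n + Σ) + (D + E) * I
      ∎
    where
    I = inv (suc n)
    D = sgnBinom′ s n
    E = sgnBinom s n
    G = telescopingTerm n s
    Σ = sumTo n (λ k → sgnBinom′ (s + 1#) k * inv (suc k ℕ.* (n C suc k)))
    inv-[n+1]*[m]Cm : ∀ m → inv (suc n ℕ.* (m C m)) ≈ I
    inv-[n+1]*[m]Cm m = reflexive (P.cong inv (P.trans (P.cong (suc n ℕ.*_) (nCn≡1 m)) (ℕP.*-identityʳ (suc n))))
    G0≈I : G 0 ≈ I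
    G0≈I = trans (*-cong (*-identityˡ _) (inv-[n+1]*[m]Cm 0)) (trans (*-congʳ (binom-zero (s + 0#))) (*-identityˡ I))
    telescoped : sumTo n (λ k → sgnBinom′ s k * inv (suc k ℕ.* (suc n C suc k))) ≈ Σ + (G n - G 0)
    telescoped = trans (sumTo-cong< n (rhs′-summand-telescopes n s))
      (trans (sumTo-distrib-+ n _ _) (+-congˡ (sumTo-telescope n G)))

  lhs≈rhs′ : ∀ n s → lhs n s ≈ rhs′ n s
  lhs≈rhs′ zero    s = sym (+-identityˡ 0#)
  lhs≈rhs′ (suc n) s = begin
    lhs (suc n) s                                                ≈⟨ lhs-suc n s ⟩
    lhs n (s + 1#) + (sgnBinom′ s n + sgnBinom s n) * inv (suc n) ≈⟨ +-congʳ (lhs≈rhs′ n (s + 1#)) ⟩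
    rhs′ n (s + 1#) + (sgnBinom′ s n + sgnBinom s n) * inv (suc n) ≈⟨ rhs′-suc n s ⟨
    rhs′ (suc n) s                                               ∎

theorem2p6 : {c ℓ : Level} (R : CommutativeRing c ℓ)
    (inv : ℕ → CommutativeRing.Carrier R)
    (inv-correct : ∀ m → CommutativeRing._≈_ R (CommutativeRing._*_ R (Gen.cast R inv (suc m)) (inv (suc m))) (CommutativeRing.1# R))
    (n : ℕ) (s : CommutativeRing.Carrier R)
    (s-ok : ∀ m → ¬ CommutativeRing._≈_ R s (CommutativeRing.-_ R (Gen.cast R inv (suc m)))) →
    CommutativeRing._≈_ R (Gen.lhs R inv n s) (Gen.rhs R inv n s)
-- Both sides are polynomials in s, so the identity holds without the hypothesis on s.
theorem2p6 R inv inv-correct n s _ = trans (lhs≈rhs′ n s) (sym (rhs≈rhs′ n s))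
  where
  open CommutativeRing R using (trans; sym)
  open InvertiblePositiveIntegers R inv inv-correct
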